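{- Let $G_1=(V_1,E_1)$ and $G_2=(V_2,E_2)$ be trees with $V_1\cap V_2=\{v\}$ and $E_1\cap E_2=\varnothing$, and let the edges of $E_1\cup E_2$ carry distinct ranks. Let $D_1$, $D_2$ and $D$ be the single-linkage dendrograms of $G_1$, $G_2$ and $G_1\cup G_2=(V_1\cup V_2,E_1\cup E_2)$, respectively. For $i=1,2$, let $e_i^\star$ be the minimum-rank edge of $G_i$ incident to $v$, and let $S_i=\mathrm{spine}_{D_i}(e_i^\star)$; if $G_i$ consists of the single vertex $v$, set $S_i=\varnothing$. Then every edge $e\in E_1\setminus S_1$ has the same parent in $D$ as in $D_1$, and every edge $e\in E_2\setminus S_2$ has the same parent in $D$ as in $D_2$.
   Context: For a tree $G=(V,E)$ whose edges have distinct ranks $r_e$ (the position of $e$ in the order of edges sorted by weight, with ties broken consistently), the single-linkage dendrogram (SLD) is defined by the following process. Start with every vertex as a singleton cluster and process the edges in increasing order of rank; processing $e=(u,v)$ merges the current clusters of $u$ and $v$. The SLD is the rooted binary tree whose leaves are the vertices and whose internal nodes are the edges. The children of node $e$ represent the two clusters merged when $e$ is processed: a leaf for a singleton cluster, and otherwise the edge whose processing created that cluster. The parent $p(e)$ of an internal node $e$ is the edge whose processing next merges the cluster created by $e$; the root, which is the last edge processed, has no parent. $\mathrm{spine}_D(e)$ is the set of internal nodes on the path from $e$ to the root of $D$, including both $e$ and the root. The ranks on $E_1$ and on $E_2$ are the restrictions of the given rank order on $E_1\cup E_2$. -}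

module Defs where

open import Data.Nat using (ℕ; _⊔_; _≤_; suc)
open import Data.Nat.Properties using (_≟_)
open import Data.Product using (_×_; _,_; proj₁; proj₂; ∃)
open import Data.Sum using (_⊎_)
open import Data.List using (List; []; _∷_; _++_; filter; foldl; foldr; upTo; deduplicate; [_]; map)
open import Data.List.Membership.Propositional using (_∈_)
open import Data.List.Membership.DecPropositional _≟_ using (_∈?_)
open import Data.List.Relation.Unary.Unique.Propositional using (Unique)
open import Data.Maybe using (Maybe; just; nothing)
open import Data.Bool using (if_then_else_)
open import Relation.Nullary using (yes; no; does; ¬_; ¬?)
open import Relation.Nullary.Decidable using (_⊎-dec_)
open import Relation.Binary.PropositionalEquality using (_≡_; refl)

-- CONVENTION: vertices are natural numbers; an edge is identified with its
-- rank (a natural number), so distinct edges have distinct ranks and the rank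
-- order is the usual order on ℕ.  A global function `ends` gives the two
-- endpoints of every edge.

Ends : Set
Ends = ℕ → ℕ × ℕ

Joins : Ends → ℕ → ℕ → ℕ → Set
Joins ends e x y = (ends e ≡ (x , y)) ⊎ (ends e ≡ (y , x))

Incident : Ends → ℕ → ℕ → Set
Incident ends v e = (proj₁ (ends e) ≡ v) ⊎ (proj₂ (ends e) ≡ v)

data Walk (ends : Ends) (E : List ℕ) : ℕ → ℕ → List ℕ → Set where
  nil  : ∀ x → Walk ends E x x []
  cons : ∀ {x y z es} e → e ∈ E → Joins ends e x y → Walk ends E y z es →
         Walk ends E x z (e ∷ es)

record IsTree (ends : Ends) (V E : List ℕ) : Set where
  field
    uniqueV   : Unique V
    uniqueE   : Unique E
    endsInV   : ∀ e → e ∈ E → (proj₁ (ends e) ∈ V) × (proj₂ (ends e) ∈ V)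
    connected : ∀ x y → x ∈ V → y ∈ V → ∃ λ es → Walk ends E x y es
    acyclic   : ∀ x es → Walk ends E x x es → Unique es → es ≡ []

-- Single-linkage dendrogram, by simulating the merging process.

-- nodes of the dendrogram: leaves (vertices) and internal nodes (edges)
data Node : Set where
  leaf node : ℕ → Node

_≟N_ : (a b : Node) → Relation.Nullary.Dec (a ≡ b)
leaf x ≟N leaf y with x ≟ y
... | yes refl = yes refl
... | no p = no λ { refl → p refl }
node x ≟N node y with x ≟ y
... | yes refl = yes refl
... | no p = no λ { refl → p refl }
leaf _ ≟N node _ = no λ ()
node _ ≟N leaf _ = no λ ()

-- a current cluster: its vertices and the dendrogram node that created it
Cluster : Set
Cluster = List ℕ × Node

clusterOf : ℕ → List Cluster → Maybe Cluster
clusterOf x [] = nothing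
clusterOf x ((A , n) ∷ cs) = if does (x ∈? A) then just (A , n) else clusterOf x cs

-- current clusters, and recorded (child , parent edge) pairs
State : Set
State = List Cluster × List (Node × ℕ)

merge : ℕ → ℕ → ℕ → State → State
merge e u w (cs , ps) with clusterOf u cs | clusterOf w cs
... | just (A , a) | just (B , b) with a ≟N b
...   | yes _ = (cs , ps)
...   | no _ = ((A ++ B , node e) ∷ filter (λ c → ¬? ((proj₂ c ≟N a) ⊎-dec (proj₂ c ≟N b))) cs
              , (a , e) ∷ (b , e) ∷ ps)
merge e u w (cs , ps) | _ | _ = (cs , ps)

process : Ends → List ℕ → State → ℕ → State
process ends E st r = if does (r ∈? E) then merge r (proj₁ (ends r)) (proj₂ (ends r)) st else st

-- process the edges of E in increasing rank order
run : Ends → List ℕ → List ℕ → State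
run ends V E = foldl (process ends E) (map (λ x → ([ x ] , leaf x)) (deduplicate _≟_ V) , [])
                     (upTo (suc (foldr _⊔_ 0 E)))

lookupParent : Node → List (Node × ℕ) → Maybe ℕ
lookupParent n [] = nothing
lookupParent n ((m , e) ∷ ps) = if does (n ≟N m) then just e else lookupParent n ps

-- parent p(e) of the internal node e in the SLD of (V,E); nothing for the root
parent : Ends → List ℕ → List ℕ → ℕ → Maybe ℕ
parent ends V E e = lookupParent (node e) (proj₂ (run ends V E))

data InSpine (ends : Ends) (V E : List ℕ) : ℕ → ℕ → Set where
  here : ∀ e → InSpine ends V E e e
  up   : ∀ {e g f} → parent ends V E e ≡ just g → InSpine ends V E g f →
         InSpine ends V E e f

MinIncident : Ends → List ℕ → ℕ → ℕ → Set
MinIncident ends E v e =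
  (e ∈ E) × Incident ends v e × (∀ f → f ∈ E → Incident ends v f → e ≤ f)

-- f ∈ S = spine_D(e*) with e* the min-rank edge incident to v
-- (empty when there is no edge incident to v, e.g. G is the single vertex v)
InS : Ends → List ℕ → List ℕ → ℕ → ℕ → Set
InS ends V E v f = ∃ λ e⋆ → MinIncident ends E v e⋆ × InSpine ends V E e⋆ f

{-# OPTIONS --safe #-}
module Submission where

-- Run the merging process on G₁, on G₂ and on G₁ ∪ G₂ side by side, one rank at a time.
-- As the two trees share only v and no edges, at every moment the clusters of the glued
-- run that avoid v are exactly the clusters avoiding v of the two separate runs, and the
-- one glued cluster containing v (the hub) contains the hubs of both separate runs and
-- carries the label of one of them.  So a merge in Gᵢ is reproduced verbatim in the glued
-- run, except that where the hub of Gᵢ is involved the glued run uses its own hub.  That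
-- discrepancy only affects the recorded parent of a hub label of Gᵢ, and every hub label
-- lies on spine(eᵢ⋆): the first merge touching v is done by the minimum-rank edge eᵢ⋆
-- incident to v, and each later hub label is the parent of the previous one.

open import Defs
open import Data.Nat using (ℕ; zero; suc; _≤_; _<_; _≤′_; _⊔_; s≤s; ≤′-refl; ≤′-step)
open import Data.Nat.Properties
  using ( _≟_; ≤-refl; ≤-trans; <-irrefl; <⇒≢; <⇒≱; <-≤-trans; ≤⇒≤′; ≤′⇒≤; m≤m⊔n; m≤n⊔m
        ; m<n⇒m<1+n; m<1+n⇒m<n∨m≡n; ≮⇒≥)
open import Data.Product using (_×_; _,_; proj₁; proj₂; ∃; ∃₂)
open import Data.Sum using (_⊎_; inj₁; inj₂; swap; [_,_]′)
open import Data.Empty using (⊥; ⊥-elim)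
open import Function using (_∘_)
open import Data.List using (List; []; _∷_; _++_; filter; foldl; foldr; upTo; deduplicate; [_]; map)
open import Data.List.Properties using (upTo-∷ʳ; foldl-∷ʳ)
open import Data.List.Membership.Propositional using (_∈_; _∉_)
open import Data.List.Membership.Propositional.Properties
  using (∈-filter⁺; ∈-filter⁻; ∈-++⁺ˡ; ∈-++⁺ʳ; ∈-++⁻; ∈-map⁺; ∈-map⁻; ∈-deduplicate⁺; ∈-deduplicate⁻)
open import Data.List.Membership.DecPropositional _≟_ using (_∈?_)
open import Data.List.Relation.Unary.Any using (here; there)
open import Data.List.Relation.Unary.Any.Properties using (singleton⁻)
open import Data.List.Relation.Unary.All using ([])
open import Data.List.Relation.Unary.AllPairs using ([]; _∷_)
open import Data.Maybe using (just)
open import Relation.Nullary using (yes; no; ¬_; ¬?)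
open import Relation.Nullary.Decidable using (_⊎-dec_)
open import Relation.Binary.PropositionalEquality using (_≡_; _≢_; refl; sym; trans; cong; subst; ≢-sym)

clusters : State → List Cluster
clusters = proj₁

links : State → List (Node × ℕ)
links = proj₂

singletonCluster : ℕ → Cluster
singletonCluster x = ([ x ] , leaf x)

initial : List ℕ → State
initial V = (map singletonCluster (deduplicate _≟_ V) , [])

stateAt : Ends → List ℕ → List ℕ → ℕ → State
stateAt ends V E k = foldl (process ends E) (initial V) (upTo k)

stateAt-suc : ∀ ends V E k → stateAt ends V E (suc k) ≡ process ends E (stateAt ends V E k) k
stateAt-suc ends V E k = trans (cong (foldl (process ends E) (initial V)) (sym (upTo-∷ʳ k)))
                               (foldl-∷ʳ (process ends E) (initial V) k (upTo k))

maxRank : List ℕ → ℕ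
maxRank = foldr _⊔_ 0

≤-maxRank : ∀ {e} E → e ∈ E → e ≤ maxRank E
≤-maxRank (f ∷ E) (here refl) = m≤m⊔n f (maxRank E)
≤-maxRank (f ∷ E) (there e∈E) = ≤-trans (≤-maxRank E e∈E) (m≤n⊔m f (maxRank E))

process-∈ : ∀ ends E s r → r ∈ E → process ends E s r ≡ merge r (proj₁ (ends r)) (proj₂ (ends r)) s
process-∈ ends E s r r∈E with r ∈? E
... | yes _ = refl
... | no r∉E = ⊥-elim (r∉E r∈E)

process-∉ : ∀ ends E s r → r ∉ E → process ends E s r ≡ s
process-∉ ends E s r r∉E with r ∈? E
... | yes r∈E = ⊥-elim (r∉E r∈E)
... | no _ = refl

without : Node → Node → List Cluster → List Cluster
without a b = filter (λ c → ¬? ((proj₂ c ≟N a) ⊎-dec (proj₂ c ≟N b)))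

∈-without⁻ : ∀ {a b cs X} → X ∈ without a b cs → X ∈ cs × ¬ (proj₂ X ≡ a ⊎ proj₂ X ≡ b)
∈-without⁻ {a} {b} = ∈-filter⁻ (λ c → ¬? ((proj₂ c ≟N a) ⊎-dec (proj₂ c ≟N b)))

∈-without⁺ : ∀ {a b cs X} → X ∈ cs → proj₂ X ≢ a → proj₂ X ≢ b → X ∈ without a b cs
∈-without⁺ {a} {b} X∈cs x≢a x≢b =
  ∈-filter⁺ (λ c → ¬? ((proj₂ c ≟N a) ⊎-dec (proj₂ c ≟N b))) X∈cs [ x≢a , x≢b ]′

fuse : Cluster → Cluster → ℕ → State → State
fuse (A , a) (B , b) e (cs , ps) = ((A ++ B , node e) ∷ without a b cs , (a , e) ∷ (b , e) ∷ ps)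

merge-fuse : ∀ e u w s {A a B b} →
  clusterOf u (clusters s) ≡ just (A , a) → clusterOf w (clusters s) ≡ just (B , b) → a ≢ b →
  merge e u w s ≡ fuse (A , a) (B , b) e s
merge-fuse e u w s {a = a} {b = b} u∈A w∈B a≢b rewrite u∈A | w∈B with a ≟N b
... | yes a≡b = ⊥-elim (a≢b a≡b)
... | no _ = refl

merge-internal : ∀ e u w s {A a B} →
  clusterOf u (clusters s) ≡ just (A , a) → clusterOf w (clusters s) ≡ just (B , a) → merge e u w s ≡ s
merge-internal e u w s {a = a} u∈A w∈B rewrite u∈A | w∈B with a ≟N a
... | yes _ = refl
... | no a≢a = ⊥-elim (a≢a refl)

Disjoint : List Cluster → Set
Disjoint cs = ∀ {X Y x} → X ∈ cs → Y ∈ cs → x ∈ proj₁ X → x ∈ proj₁ Y → X ≡ Y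

clusterOf-complete : ∀ {x cs C c} → Disjoint cs → (C , c) ∈ cs → x ∈ C → clusterOf x cs ≡ just (C , c)
clusterOf-complete {x} {(A , a) ∷ cs} disjoint C∈ x∈C with x ∈? A
... | yes x∈A = cong just (disjoint (here refl) C∈ x∈A x∈C)
clusterOf-complete disjoint (here refl) x∈C | no x∉A = ⊥-elim (x∉A x∈C)
clusterOf-complete disjoint (there C∈) x∈C | no _ =
  clusterOf-complete (λ X∈ Y∈ → disjoint (there X∈) (there Y∈)) C∈ x∈C

record WellFormed (V E : List ℕ) (k : ℕ) (cs : List Cluster) : Set where
  field
    disjoint       : Disjoint cs
    label-unique   : ∀ {C D c} → (C , c) ∈ cs → (D , c) ∈ cs → C ≡ D
    label-<        : ∀ {C e} → (C , node e) ∈ cs → e < k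
    label-∈        : ∀ {C e} → (C , node e) ∈ cs → e ∈ E
    leaf-singleton : ∀ {C x} → (C , leaf x) ∈ cs → C ≡ [ x ]
    ⊆-vertices     : ∀ {C c y} → (C , c) ∈ cs → y ∈ C → y ∈ V
    covers         : ∀ {y} → y ∈ V → ∃₂ λ C c → (C , c) ∈ cs × y ∈ C
open WellFormed

∈-leaf : ∀ {V E k cs C x} → WellFormed V E k cs → (C , leaf x) ∈ cs → x ∈ C
∈-leaf wf C∈ = subst (_ ∈_) (sym (leaf-singleton wf C∈)) (here refl)

∈-initial : ∀ {x V} → x ∈ V → singletonCluster x ∈ clusters (initial V)
∈-initial x∈V = ∈-map⁺ singletonCluster (∈-deduplicate⁺ _≟_ x∈V)

initial-mono : ∀ {V V′ X} → (∀ {x} → x ∈ V → x ∈ V′) → X ∈ clusters (initial V) → X ∈ clusters (initial V′)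
initial-mono {V} V⊆V′ X∈ with ∈-map⁻ singletonCluster X∈
... | x , x∈ , refl = ∈-initial (V⊆V′ (∈-deduplicate⁻ _≟_ V x∈))

wellFormed-initial : ∀ V E → WellFormed V E 0 (clusters (initial V))
wellFormed-initial V E = record
  { disjoint       = λ X∈ Y∈ → disjoint-singletons (singleton X∈) (singleton Y∈)
  ; label-unique   = λ C∈ D∈ → unique-singletons (singleton C∈) (singleton D∈)
  ; label-<        = no-node ∘ singleton
  ; label-∈        = no-node ∘ singleton
  ; leaf-singleton = leaf-label ∘ singleton
  ; ⊆-vertices     = vertex ∘ singleton
  ; covers         = λ {y} y∈V → [ y ] , leaf y , ∈-initial y∈V , here refl
  }
  where
  Singleton : Cluster → Set
  Singleton X = ∃ λ x → x ∈ V × X ≡ singletonCluster x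

  singleton : ∀ {X} → X ∈ clusters (initial V) → Singleton X
  singleton X∈ with ∈-map⁻ singletonCluster X∈
  ... | x , x∈ , refl = x , ∈-deduplicate⁻ _≟_ V x∈ , refl

  disjoint-singletons : ∀ {X Y z} → Singleton X → Singleton Y → z ∈ proj₁ X → z ∈ proj₁ Y → X ≡ Y
  disjoint-singletons (_ , _ , refl) (_ , _ , refl) (here refl) (here refl) = refl

  unique-singletons : ∀ {C D c} → Singleton (C , c) → Singleton (D , c) → C ≡ D
  unique-singletons (_ , _ , refl) (_ , _ , refl) = refl

  no-node : ∀ {C e} {P : Set} → Singleton (C , node e) → P
  no-node (_ , _ , ())

  leaf-label : ∀ {C x} → Singleton (C , leaf x) → C ≡ [ x ]
  leaf-label (_ , _ , refl) = refl

  vertex : ∀ {X y} → Singleton X → y ∈ proj₁ X → y ∈ V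
  vertex (_ , x∈V , refl) (here refl) = x∈V

wellFormed-suc : ∀ {V E k cs} → WellFormed V E k cs → WellFormed V E (suc k) cs
wellFormed-suc wf = record
  { disjoint = disjoint wf ; label-unique = label-unique wf ; label-< = m<n⇒m<1+n ∘ label-< wf
  ; label-∈ = label-∈ wf ; leaf-singleton = leaf-singleton wf ; ⊆-vertices = ⊆-vertices wf
  ; covers = covers wf }

wellFormed-fuse : ∀ {V E k s A a B b} → WellFormed V E k (clusters s) → k ∈ E →
  (A , a) ∈ clusters s → (B , b) ∈ clusters s → a ≢ b →
  WellFormed V E (suc k) (clusters (fuse (A , a) (B , b) k s))
wellFormed-fuse {V} {E} {k} {s} {A} {a} {B} {b} wf k∈E A∈ B∈ a≢b = record
  { disjoint = disjoint′ ; label-unique = label-unique′ ; label-< = label-<′ ; label-∈ = label-∈′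
  ; leaf-singleton = leaf-singleton′ ; ⊆-vertices = ⊆-vertices′ ; covers = covers′ }
  where
  cs = clusters s
  fused = clusters (fuse (A , a) (B , b) k s)

  old : ∀ {X} → X ∈ without a b cs → X ∈ cs
  old = proj₁ ∘ ∈-without⁻

  apart : ∀ {X x} → X ∈ without a b cs → x ∈ A ++ B → x ∈ proj₁ X → ⊥
  apart X∈ x∈AB x∈X with ∈-without⁻ X∈ | ∈-++⁻ A x∈AB
  ... | X∈cs , unfused | inj₁ x∈A = unfused (inj₁ (sym (cong proj₂ (disjoint wf A∈ X∈cs x∈A x∈X))))
  ... | X∈cs , unfused | inj₂ x∈B = unfused (inj₂ (sym (cong proj₂ (disjoint wf B∈ X∈cs x∈B x∈X))))

  disjoint′ : Disjoint fused
  disjoint′ (here refl) (here refl) _ _ = refl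
  disjoint′ (here refl) (there Y∈) x∈X x∈Y = ⊥-elim (apart Y∈ x∈X x∈Y)
  disjoint′ (there X∈) (here refl) x∈X x∈Y = ⊥-elim (apart X∈ x∈Y x∈X)
  disjoint′ (there X∈) (there Y∈) = disjoint wf (old X∈) (old Y∈)

  label-<′ : ∀ {C e} → (C , node e) ∈ fused → e < suc k
  label-<′ (here refl) = ≤-refl
  label-<′ (there C∈) = m<n⇒m<1+n (label-< wf (old C∈))

  label-unique′ : ∀ {C D c} → (C , c) ∈ fused → (D , c) ∈ fused → C ≡ D
  label-unique′ (here refl) (here refl) = refl
  label-unique′ (here refl) (there D∈) = ⊥-elim (<-irrefl refl (label-< wf (old D∈)))
  label-unique′ (there C∈) (here refl) = ⊥-elim (<-irrefl refl (label-< wf (old C∈)))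
  label-unique′ (there C∈) (there D∈) = label-unique wf (old C∈) (old D∈)

  label-∈′ : ∀ {C e} → (C , node e) ∈ fused → e ∈ E
  label-∈′ (here refl) = k∈E
  label-∈′ (there C∈) = label-∈ wf (old C∈)

  leaf-singleton′ : ∀ {C x} → (C , leaf x) ∈ fused → C ≡ [ x ]
  leaf-singleton′ (there C∈) = leaf-singleton wf (old C∈)

  ⊆-vertices′ : ∀ {C c y} → (C , c) ∈ fused → y ∈ C → y ∈ V
  ⊆-vertices′ (here refl) y∈AB = [ ⊆-vertices wf A∈ , ⊆-vertices wf B∈ ]′ (∈-++⁻ A y∈AB)
  ⊆-vertices′ (there C∈) = ⊆-vertices wf (old C∈)

  covers′ : ∀ {y} → y ∈ V → ∃₂ λ C c → (C , c) ∈ fused × y ∈ C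
  covers′ y∈V with covers wf y∈V
  ... | C , c , C∈ , y∈C with c ≟N a | c ≟N b
  ...   | yes refl | _ = A ++ B , node k , here refl , ∈-++⁺ˡ (subst (_ ∈_) (label-unique wf C∈ A∈) y∈C)
  ...   | no _ | yes refl = A ++ B , node k , here refl , ∈-++⁺ʳ A (subst (_ ∈_) (label-unique wf C∈ B∈) y∈C)
  ...   | no c≢a | no c≢b = C , c , there (∈-without⁺ C∈ c≢a c≢b) , y∈C

data Step (e u w : ℕ) (s s′ : State) : Set where
  internal : ∀ {C c} → s′ ≡ s → (C , c) ∈ clusters s → u ∈ C → w ∈ C → Step e u w s s′
  fusing   : ∀ {A a B b} → s′ ≡ fuse (A , a) (B , b) e s →
             (A , a) ∈ clusters s → u ∈ A → (B , b) ∈ clusters s → w ∈ B → a ≢ b → Step e u w s s′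

merge-step : ∀ {V E k} e u w s → WellFormed V E k (clusters s) → u ∈ V → w ∈ V →
  Step e u w s (merge e u w s)
merge-step e u w s wf u∈V w∈V with covers wf u∈V | covers wf w∈V
... | A , a , A∈ , u∈A | B , b , B∈ , w∈B with a ≟N b
...   | yes refl = internal (merge-internal e u w s u↦A w↦B) A∈ u∈A (subst (w ∈_) (label-unique wf B∈ A∈) w∈B)
  where u↦A = clusterOf-complete (disjoint wf) A∈ u∈A
        w↦B = clusterOf-complete (disjoint wf) B∈ w∈B
...   | no a≢b = fusing (merge-fuse e u w s u↦A w↦B a≢b) A∈ u∈A B∈ w∈B a≢b
  where u↦A = clusterOf-complete (disjoint wf) A∈ u∈A
        w↦B = clusterOf-complete (disjoint wf) B∈ w∈B
lookupParent-hit : ∀ {n m} r ps → m ≡ n → lookupParent n ((m , r) ∷ ps) ≡ just r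
lookupParent-hit {n} r ps refl with n ≟N n
... | yes _ = refl
... | no n≢n = ⊥-elim (n≢n refl)

lookupParent-skip : ∀ {n m} r ps → n ≢ m → lookupParent n ((m , r) ∷ ps) ≡ lookupParent n ps
lookupParent-skip {n} {m} r ps n≢m with n ≟N m
... | yes n≡m = ⊥-elim (n≢m n≡m)
... | no _ = refl

lookupParent-∷ : ∀ {n} m r ps qs → lookupParent n ps ≡ lookupParent n qs →
  lookupParent n ((m , r) ∷ ps) ≡ lookupParent n ((m , r) ∷ qs)
lookupParent-∷ {n} m r _ _ eq with n ≟N m
... | yes _ = refl
... | no _ = eq

lookupParent-fuse : ∀ {n} X Y k s → n ≢ proj₂ X → n ≢ proj₂ Y →
  lookupParent n (links (fuse X Y k s)) ≡ lookupParent n (links s)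
lookupParent-fuse X (_ , b) k s n≢a n≢b =
  trans (lookupParent-skip k ((b , k) ∷ links s) n≢a) (lookupParent-skip k (links s) n≢b)

node-injective : ∀ {e f} → node e ≡ node f → e ≡ f
node-injective refl = refl

-- Once e labels no current cluster, no later merge can record another parent for it.
Settled : ℕ → ℕ → State → Set
Settled e r s = lookupParent (node e) (links s) ≡ just r × (∀ C → (C , node e) ∉ clusters s)

fuse-preserves-settled : ∀ {e r k s A a B b} → e ≢ k → (A , a) ∈ clusters s → (B , b) ∈ clusters s →
  Settled e r s → Settled e r (fuse (A , a) (B , b) k s)
fuse-preserves-settled {e} {k = k} {s} {A} {a} {B} {b} e≢k A∈ B∈ (recorded , retired) =
    trans (lookupParent-fuse (A , a) (B , b) k s (λ { refl → retired _ A∈ }) (λ { refl → retired _ B∈ }))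
          recorded
  , λ { C (here eq) → e≢k (node-injective (cong proj₂ eq))
      ; C (there C∈) → retired C (proj₁ (∈-without⁻ {a} {b} C∈)) }

fuse-settles-left : ∀ {e k s A B b} → e ≢ k → Settled e k (fuse (A , node e) (B , b) k s)
fuse-settles-left {e} {k} {s} {b = b} e≢k =
    lookupParent-hit {node e} k ((b , k) ∷ links s) refl
  , λ { C (here eq) → e≢k (node-injective (cong proj₂ eq))
      ; C (there C∈) → proj₂ (∈-without⁻ {node e} {b} {clusters s} C∈) (inj₁ refl) }

fuse-settles-right : ∀ {e k s A a B} → e ≢ k → a ≢ node e →
  Settled e k (fuse (A , a) (B , node e) k s)
fuse-settles-right {e} {k} {s} {a = a} e≢k a≢e =
    trans (lookupParent-skip {node e} {a} k ((node e , k) ∷ links s) (≢-sym a≢e))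
          (lookupParent-hit {node e} k (links s) refl)
  , λ { C (here eq) → e≢k (node-injective (cong proj₂ eq))
      ; C (there C∈) → proj₂ (∈-without⁻ {a} {node e} {clusters s} C∈) (inj₂ refl) }

EndsIn : Ends → List ℕ → List ℕ → Set
EndsIn ends V E = ∀ e → e ∈ E → (proj₁ (ends e) ∈ V) × (proj₂ (ends e) ∈ V)

Loopless : Ends → List ℕ → Set
Loopless ends E = ∀ e → e ∈ E → proj₁ (ends e) ≢ proj₂ (ends e)

tree-loopless : ∀ {ends V E} → IsTree ends V E → Loopless ends E
tree-loopless {ends} {E = E} T e e∈E u≡w
  with IsTree.acyclic T (proj₁ (ends e)) (e ∷ [])
         (cons e e∈E (inj₁ refl) (subst (λ x → Walk ends E x (proj₁ (ends e)) []) u≡w (nil _)))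
         ([] ∷ [])
... | ()

SpineLabelled : ℕ → (ℕ → Set) → List Cluster → Set
SpineLabelled v S cs = ∀ {A a} → (A , a) ∈ cs → v ∈ A → a ≡ leaf v ⊎ ∃ λ e → a ≡ node e × S e

spine-label≢ : ∀ {v S cs A a e} → SpineLabelled v S cs → (A , a) ∈ cs → v ∈ A → ¬ S e → node e ≢ a
spine-label≢ labelled A∈ v∈A e∉S e≡a with labelled A∈ v∈A | e≡a
... | inj₁ refl | ()
... | inj₂ (_ , refl , e∈S) | refl = e∉S e∈S

InSpine-extend : ∀ {ends V E e f g} → InSpine ends V E e f → parent ends V E f ≡ just g →
  InSpine ends V E e g
InSpine-extend (here _) f↦g = up f↦g (here _)
InSpine-extend (up e↦e′ e′⇝f) f↦g = up e↦e′ (InSpine-extend e′⇝f f↦g)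

Incident-inside : ∀ {ends v k C} → Incident ends v k → proj₁ (ends k) ∈ C → proj₂ (ends k) ∈ C →
  v ∈ C
Incident-inside (inj₁ refl) u∈C _ = u∈C
Incident-inside (inj₂ refl) _ w∈C = w∈C

module Run (ends : Ends) (V E : List ℕ) (endsIn : EndsIn ends V E) where

  state : ℕ → State
  state = stateAt ends V E

  data Transition (k : ℕ) : Set where
    skip : k ∉ E → state (suc k) ≡ state k → Transition k
    edge : k ∈ E → Step k (proj₁ (ends k)) (proj₂ (ends k)) (state k) (state (suc k)) → Transition k

  private
    transition′ : ∀ k → WellFormed V E k (clusters (state k)) → Transition k
    transition′ k wf with k ∈? E
    ... | no k∉E = skip k∉E (trans (stateAt-suc ends V E k) (process-∉ ends E (state k) k k∉E))
    ... | yes k∈E = edge k∈E (subst (Step k u w (state k)) (sym next) (merge-step k u w (state k) wf u∈V w∈V))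
      where
      u = proj₁ (ends k)
      w = proj₂ (ends k)
      u∈V = proj₁ (endsIn k k∈E)
      w∈V = proj₂ (endsIn k k∈E)
      next : state (suc k) ≡ merge k u w (state k)
      next = trans (stateAt-suc ends V E k) (process-∈ ends E (state k) k k∈E)

  wellFormed : ∀ k → WellFormed V E k (clusters (state k))
  wellFormed zero = wellFormed-initial V E
  wellFormed (suc k) with transition′ k (wellFormed k)
  ... | skip _ eq = subst (WellFormed V E (suc k) ∘ clusters) (sym eq) (wellFormed-suc (wellFormed k))
  ... | edge _ (internal eq _ _ _) =
    subst (WellFormed V E (suc k) ∘ clusters) (sym eq) (wellFormed-suc (wellFormed k))
  ... | edge k∈E (fusing eq A∈ _ B∈ _ a≢b) =
    subst (WellFormed V E (suc k) ∘ clusters) (sym eq)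
          (wellFormed-fuse {s = state k} (wellFormed k) k∈E A∈ B∈ a≢b)

  transition : ∀ k → Transition k
  transition k = transition′ k (wellFormed k)

  state-constant : ∀ {k n} → (∀ f → f ∈ E → f < k) → k ≤′ n → state n ≡ state k
  state-constant below ≤′-refl = refl
  state-constant below (≤′-step {n} k≤′n) with transition n
  ... | skip _ eq = trans eq (state-constant below k≤′n)
  ... | edge n∈E _ = ⊥-elim (<⇒≱ (below n n∈E) (≤′⇒≤ k≤′n))

  below-final : ∀ f → f ∈ E → f < suc (maxRank E)
  below-final f f∈E = s≤s (≤-maxRank E f∈E)

  state-run : ∀ {n} → (∀ f → f ∈ E → f < n) → state n ≡ run ends V E
  state-run {n} below = trans (sym (state-constant below (≤⇒≤′ (m≤m⊔n n (suc (maxRank E))))))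
                              (state-constant below-final (≤⇒≤′ (m≤n⊔m n (suc (maxRank E)))))

  settled-persists : ∀ {e r k n} → e < k → k ≤′ n → Settled e r (state k) → Settled e r (state n)
  settled-persists e<k ≤′-refl σ = σ
  settled-persists {e} {r} e<k (≤′-step {n} k≤′n) σ with transition n | settled-persists e<k k≤′n σ
  ... | skip _ eq | σ′ = subst (Settled e r) (sym eq) σ′
  ... | edge _ (internal eq _ _ _) | σ′ = subst (Settled e r) (sym eq) σ′
  ... | edge _ (fusing eq A∈ _ B∈ _ _) | σ′ =
    subst (Settled e r) (sym eq) (fuse-preserves-settled {s = state n} e≢n A∈ B∈ σ′)
    where e≢n = <⇒≢ (<-≤-trans e<k (≤′⇒≤ k≤′n))

  settled⇒parent : ∀ {e r k} → e < k → Settled e r (state k) → parent ends V E e ≡ just r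
  settled⇒parent {e} {r} {k} e<k σ =
    proj₁ (subst (Settled e r) (state-run {n} (λ f f∈E → <-≤-trans (below-final f f∈E) (m≤n⊔m k _)))
                 (settled-persists e<k (≤⇒≤′ (m≤m⊔n k _)) σ))
    where n = k ⊔ suc (maxRank E)

  module Spine (v : ℕ) (loopless : Loopless ends E) where

    S : ℕ → Set
    S = InS ends V E v

    Isolated : ℕ → Set
    Isolated k = ∀ {A} → (A , leaf v) ∈ clusters (state k) → ∀ f → f ∈ E → f < k → ¬ Incident ends v f

    record SpineInvariant (k : ℕ) : Set where
      field
        spine-labelled : SpineLabelled v S (clusters (state k))
        isolated       : Isolated k
    open SpineInvariant

    label-of-v : ∀ {k X x A} → (X , x) ∈ clusters (state k) → v ∈ X → (A , leaf v) ∈ clusters (state k) →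
                 x ≡ leaf v
    label-of-v {k} X∈ v∈X A∈ = cong proj₂ (disjoint (wellFormed k) X∈ A∈ v∈X (∈-leaf (wellFormed k) A∈))

    -- p is the endpoint of k lying in A; when A is still the singleton {v}, k is then e⋆.
    fused-on-spine : ∀ {k A a p} → SpineInvariant k → k ∈ E → (A , a) ∈ clusters (state k) → v ∈ A →
                     p ∈ A → (p ≡ v → Incident ends v k) →
                     (∀ {e} → a ≡ node e → Settled e k (state (suc k))) → S k
    fused-on-spine {k} {p = p} I k∈E A∈ v∈A p∈A incident settled with spine-labelled I A∈ v∈A
    ... | inj₁ refl = k , (k∈E , incident p≡v , minimal) , here k
      where p≡v = singleton⁻ (subst (p ∈_) (leaf-singleton (wellFormed k) A∈) p∈A)
            minimal = λ f f∈E f-incident → ≮⇒≥ (λ f<k → isolated I A∈ f f∈E f<k f-incident)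
    ... | inj₂ (e , refl , e⋆ , e⋆-minimal , e⋆⇝e) = e⋆ , e⋆-minimal , InSpine-extend e⋆⇝e e↦k
      where e↦k = settled⇒parent (m<n⇒m<1+n (label-< (wellFormed k) A∈)) (settled refl)

    spine-labelled-suc : ∀ {k} → SpineInvariant k → Transition k →
                         SpineLabelled v S (clusters (state (suc k)))
    spine-labelled-suc I (skip _ eq) = subst (SpineLabelled v S ∘ clusters) (sym eq) (spine-labelled I)
    spine-labelled-suc I (edge _ (internal eq _ _ _)) =
      subst (SpineLabelled v S ∘ clusters) (sym eq) (spine-labelled I)
    spine-labelled-suc {k} I (edge k∈E (fusing {A} {a} {B} {b} eq A∈ u∈A B∈ w∈B a≢b)) =
      subst (SpineLabelled v S ∘ clusters) (sym eq) fused-labelled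
      where
      wf = wellFormed k

      fused-labelled : SpineLabelled v S (clusters (fuse (A , a) (B , b) k (state k)))
      fused-labelled (here refl) v∈AB with ∈-++⁻ A v∈AB
      ... | inj₁ v∈A = inj₂ (k , refl , fused-on-spine I k∈E A∈ v∈A u∈A inj₁ λ { refl →
              subst (Settled _ k) (sym eq)
                    (fuse-settles-left {s = state k} {A} {B} {b} (<⇒≢ (label-< wf A∈))) })
      ... | inj₂ v∈B = inj₂ (k , refl , fused-on-spine I k∈E B∈ v∈B w∈B inj₂ λ { refl →
              subst (Settled _ k) (sym eq)
                    (fuse-settles-right {s = state k} {A} {a} {B} (<⇒≢ (label-< wf B∈)) a≢b) })
      fused-labelled (there X∈) = spine-labelled I (proj₁ (∈-without⁻ {a} {b} X∈))

    leaf-persists : ∀ {k A} → Transition k → (A , leaf v) ∈ clusters (state (suc k)) →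
                    (A , leaf v) ∈ clusters (state k)
    leaf-persists (skip _ eq) = subst (λ s → (_ , leaf v) ∈ clusters s) eq
    leaf-persists (edge _ (internal eq _ _ _)) = subst (λ s → (_ , leaf v) ∈ clusters s) eq
    leaf-persists (edge _ (fusing {a = a} {b = b} eq _ _ _ _ _)) A∈
      with subst (λ s → (_ , leaf v) ∈ clusters s) eq A∈
    ... | here ()
    ... | there A∈′ = proj₁ (∈-without⁻ {a} {b} A∈′)

    current-not-incident : ∀ {k A} → Transition k → (A , leaf v) ∈ clusters (state (suc k)) → k ∈ E →
                           ¬ Incident ends v k
    current-not-incident (skip k∉E _) _ k∈E _ = k∉E k∈E
    current-not-incident {k} (edge _ (internal eq C∈ u∈C w∈C)) A∈ k∈E incident
      with disjoint wf C∈ A∈′ (Incident-inside {ends} {v} {k} incident u∈C w∈C) (∈-leaf wf A∈′)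
      where wf = wellFormed k
            A∈′ = subst (λ s → (_ , leaf v) ∈ clusters s) eq A∈
    ... | refl = loopless k k∈E (trans (endpoint u∈C) (sym (endpoint w∈C)))
      where endpoint = λ {x} x∈C → singleton⁻ (subst (x ∈_) (leaf-singleton (wellFormed k) C∈) x∈C)
    current-not-incident {k} (edge _ (fusing {a = a} {b = b} eq A′∈ u∈A′ B′∈ w∈B′ _)) A∈ k∈E incident
      with subst (λ s → (_ , leaf v) ∈ clusters s) eq A∈
    ... | here ()
    ... | there A∈′ with ∈-without⁻ {a} {b} {clusters (state k)} A∈′ | incident
    ...   | A∈cs , unfused | inj₁ u≡v = unfused (inj₁ (sym (label-of-v {k} A′∈ (subst (_∈ _) u≡v u∈A′) A∈cs)))
    ...   | A∈cs , unfused | inj₂ w≡v = unfused (inj₂ (sym (label-of-v {k} B′∈ (subst (_∈ _) w≡v w∈B′) A∈cs)))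

    isolated-suc : ∀ {k} → SpineInvariant k → Isolated (suc k)
    isolated-suc {k} I A∈ f f∈E f<1+k with m<1+n⇒m<n∨m≡n f<1+k
    ... | inj₁ f<k = isolated I (leaf-persists (transition k) A∈) f f∈E f<k
    ... | inj₂ refl = current-not-incident (transition k) A∈ f∈E

    spineInvariant : ∀ k → SpineInvariant k
    spineInvariant zero = record { spine-labelled = initial-labelled ; isolated = λ _ _ _ () }
      where
      initial-labelled : SpineLabelled v S (clusters (state 0))
      initial-labelled A∈ v∈A with ∈-map⁻ singletonCluster A∈
      initial-labelled A∈ (here refl) | _ , _ , refl = inj₁ refl
    spineInvariant (suc k) = record
      { spine-labelled = spine-labelled-suc (spineInvariant k) (transition k)
      ; isolated = isolated-suc (spineInvariant k) }

record Glued (v : ℕ) (E₁ E₂ : List ℕ) (S₁ S₂ : ℕ → Set) (s s₁ s₂ : State) : Set where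
  field
    away₁ : ∀ {C c} → (C , c) ∈ clusters s₁ → v ∉ C → (C , c) ∈ clusters s
    away₂ : ∀ {C c} → (C , c) ∈ clusters s₂ → v ∉ C → (C , c) ∈ clusters s
    hub hub₁ hub₂ : List ℕ
    hubLabel hubLabel₁ hubLabel₂ : Node
    hub∈  : (hub , hubLabel) ∈ clusters s
    hub∈₁ : (hub₁ , hubLabel₁) ∈ clusters s₁
    hub∈₂ : (hub₂ , hubLabel₂) ∈ clusters s₂
    v∈hub  : v ∈ hub
    v∈hub₁ : v ∈ hub₁
    v∈hub₂ : v ∈ hub₂
    hub₁⊆hub : ∀ {x} → x ∈ hub₁ → x ∈ hub
    hub₂⊆hub : ∀ {x} → x ∈ hub₂ → x ∈ hub
    hubLabel-inherited : hubLabel ≡ hubLabel₁ ⊎ hubLabel ≡ hubLabel₂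
    parents₁ : ∀ e → e ∈ E₁ → ¬ S₁ e → lookupParent (node e) (links s) ≡ lookupParent (node e) (links s₁)
    parents₂ : ∀ e → e ∈ E₂ → ¬ S₂ e → lookupParent (node e) (links s) ≡ lookupParent (node e) (links s₂)

Glued-swap : ∀ {v E₁ E₂ S₁ S₂ s s₁ s₂} → Glued v E₁ E₂ S₁ S₂ s s₁ s₂ → Glued v E₂ E₁ S₂ S₁ s s₂ s₁
Glued-swap G = record
  { away₁ = away₂ ; away₂ = away₁
  ; hub = hub ; hub₁ = hub₂ ; hub₂ = hub₁
  ; hubLabel = hubLabel ; hubLabel₁ = hubLabel₂ ; hubLabel₂ = hubLabel₁
  ; hub∈ = hub∈ ; hub∈₁ = hub∈₂ ; hub∈₂ = hub∈₁ ; v∈hub = v∈hub ; v∈hub₁ = v∈hub₂ ; v∈hub₂ = v∈hub₁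
  ; hub₁⊆hub = hub₂⊆hub ; hub₂⊆hub = hub₁⊆hub ; hubLabel-inherited = swap hubLabel-inherited
  ; parents₁ = parents₂ ; parents₂ = parents₁ }
  where open Glued G

module GluedStep
  (V₁ V₂ E₁ E₂ : List ℕ) (v : ℕ) (S₁ S₂ : ℕ → Set)
  (V₁∩V₂ : ∀ x → x ∈ V₁ → x ∈ V₂ → x ≡ v) (E₁∩E₂ : ∀ e → e ∈ E₁ → e ∉ E₂)
  {V E : List ℕ} (k : ℕ) (s s₁ s₂ : State)
  (wf : WellFormed V E k (clusters s))
  (wf₁ : WellFormed V₁ E₁ k (clusters s₁)) (wf₂ : WellFormed V₂ E₂ k (clusters s₂))
  (labelled₁ : SpineLabelled v S₁ (clusters s₁)) (labelled₂ : SpineLabelled v S₂ (clusters s₂))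
  (G : Glued v E₁ E₂ S₁ S₂ s s₁ s₂) where

  open Glued G
  cs = clusters s
  cs₁ = clusters s₁
  cs₂ = clusters s₂

  shared-label-contains-v : ∀ {X Y x} → (X , x) ∈ cs₁ → (Y , x) ∈ cs₂ → v ∈ X
  shared-label-contains-v {X} {x = leaf y} X∈ Y∈ = subst (_∈ X) (V₁∩V₂ y y∈V₁ y∈V₂) (∈-leaf wf₁ X∈)
    where y∈V₁ = ⊆-vertices wf₁ X∈ (∈-leaf wf₁ X∈)
          y∈V₂ = ⊆-vertices wf₂ Y∈ (∈-leaf wf₂ Y∈)
  shared-label-contains-v {x = node e} X∈ Y∈ = ⊥-elim (E₁∩E₂ e (label-∈ wf₁ X∈) (label-∈ wf₂ Y∈))

  away-labels-differ : ∀ {X x Y y} → (X , x) ∈ cs₂ → v ∉ X → (Y , y) ∈ cs₁ → v ∉ Y → x ≢ y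
  away-labels-differ X∈ _ Y∈ v∉Y refl = v∉Y (shared-label-contains-v Y∈ X∈)

  label₁≢edge₂ : ∀ {X x e} → (X , x) ∈ cs₁ → e ∈ E₂ → node e ≢ x
  label₁≢edge₂ X∈ e∈E₂ refl = E₁∩E₂ _ (label-∈ wf₁ X∈) e∈E₂

  label₂≢edge₁ : ∀ {X x e} → (X , x) ∈ cs₂ → e ∈ E₁ → node e ≢ x
  label₂≢edge₁ X∈ e∈E₁ refl = E₁∩E₂ _ e∈E₁ (label-∈ wf₂ X∈)

  hubLabel≢off-spine₁ : ∀ {e} → e ∈ E₁ → ¬ S₁ e → node e ≢ hubLabel
  hubLabel≢off-spine₁ e∈E₁ e∉S₁ e≡hub with hubLabel-inherited
  ... | inj₁ hub≡hub₁ = spine-label≢ labelled₁ hub∈₁ v∈hub₁ e∉S₁ (trans e≡hub hub≡hub₁)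
  ... | inj₂ hub≡hub₂ = label₂≢edge₁ hub∈₂ e∈E₁ (trans e≡hub hub≡hub₂)

  hubLabel≢off-spine₂ : ∀ {e} → e ∈ E₂ → ¬ S₂ e → node e ≢ hubLabel
  hubLabel≢off-spine₂ e∈E₂ e∉S₂ e≡hub with hubLabel-inherited
  ... | inj₁ hub≡hub₁ = label₁≢edge₂ hub∈₁ e∈E₂ (trans e≡hub hub≡hub₁)
  ... | inj₂ hub≡hub₂ = spine-label≢ labelled₂ hub∈₂ v∈hub₂ e∉S₂ (trans e≡hub hub≡hub₂)

  away≢hubLabel : ∀ {X x} → (X , x) ∈ cs → v ∉ X → x ≢ hubLabel
  away≢hubLabel X∈ v∉X refl = v∉X (subst (v ∈_) (sym (label-unique wf X∈ hub∈)) v∈hub)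

  away≢hubLabel₁ : ∀ {X x} → (X , x) ∈ cs₁ → v ∉ X → x ≢ hubLabel₁
  away≢hubLabel₁ X∈ v∉X refl = v∉X (subst (v ∈_) (sym (label-unique wf₁ X∈ hub∈₁)) v∈hub₁)

  both-away : ∀ {P p Q q} → (P , p) ∈ cs₁ → v ∉ P → (Q , q) ∈ cs₁ → v ∉ Q →
    Glued v E₁ E₂ S₁ S₂ (fuse (P , p) (Q , q) k s) (fuse (P , p) (Q , q) k s₁) s₂
  both-away {P} {p} {Q} {q} P∈ v∉P Q∈ v∉Q = record
    { away₁ = away₁′
    ; away₂ = λ C∈ v∉C → there (∈-without⁺ (away₂ C∈ v∉C)
                                  (away-labels-differ C∈ v∉C P∈ v∉P) (away-labels-differ C∈ v∉C Q∈ v∉Q))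
    ; hub = hub ; hub₁ = hub₁ ; hub₂ = hub₂
    ; hubLabel = hubLabel ; hubLabel₁ = hubLabel₁ ; hubLabel₂ = hubLabel₂
    ; hub∈ = there (∈-without⁺ hub∈ (≢-sym (away≢hubLabel (away₁ P∈ v∉P) v∉P))
                                    (≢-sym (away≢hubLabel (away₁ Q∈ v∉Q) v∉Q)))
    ; hub∈₁ = there (∈-without⁺ hub∈₁ (≢-sym (away≢hubLabel₁ P∈ v∉P)) (≢-sym (away≢hubLabel₁ Q∈ v∉Q)))
    ; hub∈₂ = hub∈₂ ; v∈hub = v∈hub ; v∈hub₁ = v∈hub₁ ; v∈hub₂ = v∈hub₂
    ; hub₁⊆hub = hub₁⊆hub ; hub₂⊆hub = hub₂⊆hub ; hubLabel-inherited = hubLabel-inherited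
    ; parents₁ = parents₁′ ; parents₂ = parents₂′
    }
    where
    away₁′ : ∀ {C c} → (C , c) ∈ clusters (fuse (P , p) (Q , q) k s₁) → v ∉ C →
             (C , c) ∈ clusters (fuse (P , p) (Q , q) k s)
    away₁′ (here refl) _ = here refl
    away₁′ (there C∈) v∉C with ∈-without⁻ {p} {q} {cs₁} C∈
    ... | C∈cs₁ , unfused = there (∈-without⁺ (away₁ C∈cs₁ v∉C) (unfused ∘ inj₁) (unfused ∘ inj₂))

    parents₁′ : ∀ e → e ∈ E₁ → ¬ S₁ e → lookupParent (node e) (links (fuse (P , p) (Q , q) k s))
                                       ≡ lookupParent (node e) (links (fuse (P , p) (Q , q) k s₁))
    parents₁′ e e∈E₁ e∉S₁ =
      lookupParent-∷ p k ((q , k) ∷ links s) ((q , k) ∷ links s₁)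
        (lookupParent-∷ q k (links s) (links s₁) (parents₁ e e∈E₁ e∉S₁))

    parents₂′ : ∀ e → e ∈ E₂ → ¬ S₂ e → lookupParent (node e) (links (fuse (P , p) (Q , q) k s))
                                       ≡ lookupParent (node e) (links s₂)
    parents₂′ e e∈E₂ e∉S₂ =
      trans (lookupParent-fuse (P , p) (Q , q) k s (label₁≢edge₂ P∈ e∈E₂) (label₁≢edge₂ Q∈ e∈E₂))
            (parents₂ e e∈E₂ e∉S₂)

  hub-left : ∀ {Q q} → (Q , q) ∈ cs₁ → v ∉ Q →
    Glued v E₁ E₂ S₁ S₂ (fuse (hub , hubLabel) (Q , q) k s) (fuse (hub₁ , hubLabel₁) (Q , q) k s₁) s₂
  hub-left {Q} {q} Q∈ v∉Q = record
    { away₁ = away₁′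
    ; away₂ = λ C∈ v∉C → there (∈-without⁺ (away₂ C∈ v∉C)
                                  (away≢hubLabel (away₂ C∈ v∉C) v∉C) (away-labels-differ C∈ v∉C Q∈ v∉Q))
    ; hub = hub ++ Q ; hub₁ = hub₁ ++ Q ; hub₂ = hub₂
    ; hubLabel = node k ; hubLabel₁ = node k ; hubLabel₂ = hubLabel₂
    ; hub∈ = here refl ; hub∈₁ = here refl ; hub∈₂ = hub∈₂
    ; v∈hub = ∈-++⁺ˡ v∈hub ; v∈hub₁ = ∈-++⁺ˡ v∈hub₁ ; v∈hub₂ = v∈hub₂
    ; hub₁⊆hub = λ x∈ → [ ∈-++⁺ˡ ∘ hub₁⊆hub , ∈-++⁺ʳ hub ]′ (∈-++⁻ hub₁ x∈)
    ; hub₂⊆hub = ∈-++⁺ˡ ∘ hub₂⊆hub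
    ; hubLabel-inherited = inj₁ refl
    ; parents₁ = parents₁′ ; parents₂ = parents₂′
    }
    where
    away₁′ : ∀ {C c} → (C , c) ∈ clusters (fuse (hub₁ , hubLabel₁) (Q , q) k s₁) → v ∉ C →
             (C , c) ∈ clusters (fuse (hub , hubLabel) (Q , q) k s)
    away₁′ (here refl) v∉C = ⊥-elim (v∉C (∈-++⁺ˡ v∈hub₁))
    away₁′ (there C∈) v∉C with ∈-without⁻ {hubLabel₁} {q} {cs₁} C∈
    ... | C∈cs₁ , unfused =
      there (∈-without⁺ (away₁ C∈cs₁ v∉C) (away≢hubLabel (away₁ C∈cs₁ v∉C) v∉C) (unfused ∘ inj₂))

    parents₁′ : ∀ e → e ∈ E₁ → ¬ S₁ e → lookupParent (node e) (links (fuse (hub , hubLabel) (Q , q) k s))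
                                       ≡ lookupParent (node e) (links (fuse (hub₁ , hubLabel₁) (Q , q) k s₁))
    parents₁′ e e∈E₁ e∉S₁ =
      trans (lookupParent-skip k ((q , k) ∷ links s) (hubLabel≢off-spine₁ e∈E₁ e∉S₁))
            (trans (lookupParent-∷ q k (links s) (links s₁) (parents₁ e e∈E₁ e∉S₁))
                   (sym (lookupParent-skip k ((q , k) ∷ links s₁) (spine-label≢ labelled₁ hub∈₁ v∈hub₁ e∉S₁))))

    parents₂′ : ∀ e → e ∈ E₂ → ¬ S₂ e → lookupParent (node e) (links (fuse (hub , hubLabel) (Q , q) k s))
                                       ≡ lookupParent (node e) (links s₂)
    parents₂′ e e∈E₂ e∉S₂ =
      trans (lookupParent-fuse (hub , hubLabel) (Q , q) k s
                               (hubLabel≢off-spine₂ e∈E₂ e∉S₂) (label₁≢edge₂ Q∈ e∈E₂))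
            (parents₂ e e∈E₂ e∉S₂)

  hub-right : ∀ {P p} → (P , p) ∈ cs₁ → v ∉ P →
    Glued v E₁ E₂ S₁ S₂ (fuse (P , p) (hub , hubLabel) k s) (fuse (P , p) (hub₁ , hubLabel₁) k s₁) s₂
  hub-right {P} {p} P∈ v∉P = record
    { away₁ = away₁′
    ; away₂ = λ C∈ v∉C → there (∈-without⁺ (away₂ C∈ v∉C)
                                  (away-labels-differ C∈ v∉C P∈ v∉P) (away≢hubLabel (away₂ C∈ v∉C) v∉C))
    ; hub = P ++ hub ; hub₁ = P ++ hub₁ ; hub₂ = hub₂
    ; hubLabel = node k ; hubLabel₁ = node k ; hubLabel₂ = hubLabel₂
    ; hub∈ = here refl ; hub∈₁ = here refl ; hub∈₂ = hub∈₂
    ; v∈hub = ∈-++⁺ʳ P v∈hub ; v∈hub₁ = ∈-++⁺ʳ P v∈hub₁ ; v∈hub₂ = v∈hub₂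
    ; hub₁⊆hub = λ x∈ → [ ∈-++⁺ˡ , ∈-++⁺ʳ P ∘ hub₁⊆hub ]′ (∈-++⁻ P x∈)
    ; hub₂⊆hub = ∈-++⁺ʳ P ∘ hub₂⊆hub
    ; hubLabel-inherited = inj₁ refl
    ; parents₁ = parents₁′ ; parents₂ = parents₂′
    }
    where
    away₁′ : ∀ {C c} → (C , c) ∈ clusters (fuse (P , p) (hub₁ , hubLabel₁) k s₁) → v ∉ C →
             (C , c) ∈ clusters (fuse (P , p) (hub , hubLabel) k s)
    away₁′ (here refl) v∉C = ⊥-elim (v∉C (∈-++⁺ʳ P v∈hub₁))
    away₁′ (there C∈) v∉C with ∈-without⁻ {p} {hubLabel₁} {cs₁} C∈
    ... | C∈cs₁ , unfused =
      there (∈-without⁺ (away₁ C∈cs₁ v∉C) (unfused ∘ inj₁) (away≢hubLabel (away₁ C∈cs₁ v∉C) v∉C))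

    parents₁′ : ∀ e → e ∈ E₁ → ¬ S₁ e → lookupParent (node e) (links (fuse (P , p) (hub , hubLabel) k s))
                                       ≡ lookupParent (node e) (links (fuse (P , p) (hub₁ , hubLabel₁) k s₁))
    parents₁′ e e∈E₁ e∉S₁ =
      lookupParent-∷ p k ((hubLabel , k) ∷ links s) ((hubLabel₁ , k) ∷ links s₁)
        (trans (lookupParent-skip k (links s) (hubLabel≢off-spine₁ e∈E₁ e∉S₁))
               (trans (parents₁ e e∈E₁ e∉S₁)
                      (sym (lookupParent-skip k (links s₁) (spine-label≢ labelled₁ hub∈₁ v∈hub₁ e∉S₁)))))

    parents₂′ : ∀ e → e ∈ E₂ → ¬ S₂ e → lookupParent (node e) (links (fuse (P , p) (hub , hubLabel) k s))
                                       ≡ lookupParent (node e) (links s₂)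
    parents₂′ e e∈E₂ e∉S₂ =
      trans (lookupParent-fuse (P , p) (hub , hubLabel) k s
                               (label₁≢edge₂ P∈ e∈E₂) (hubLabel≢off-spine₂ e∈E₂ e∉S₂))
            (parents₂ e e∈E₂ e∉S₂)

  combined-cluster : ∀ {P p C c y} → (P , p) ∈ cs₁ → y ∈ P → (C , c) ∈ cs → y ∈ C →
    (v ∈ P × (C , c) ≡ (hub , hubLabel)) ⊎ (v ∉ P × (C , c) ≡ (P , p))
  combined-cluster {P} P∈ y∈P C∈ y∈C with v ∈? P
  ... | yes v∈P = inj₁ (v∈P , disjoint wf C∈ hub∈ y∈C
                                (hub₁⊆hub (subst (_ ∈_) (cong proj₁ (disjoint wf₁ P∈ hub∈₁ v∈P v∈hub₁)) y∈P)))
  ... | no v∉P = inj₂ (v∉P , disjoint wf C∈ (away₁ P∈ v∉P) y∈C y∈P)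

  separated : ∀ {u w P p Q q C c} → (P , p) ∈ cs₁ → u ∈ P → (Q , q) ∈ cs₁ → w ∈ Q → p ≢ q →
    (C , c) ∈ cs → u ∈ C → w ∈ C → ⊥
  separated P∈ u∈P Q∈ w∈Q p≢q C∈ u∈C w∈C with combined-cluster P∈ u∈P C∈ u∈C | combined-cluster Q∈ w∈Q C∈ w∈C
  ... | inj₁ (v∈P , _) | inj₁ (v∈Q , _) = p≢q (cong proj₂ (disjoint wf₁ P∈ Q∈ v∈P v∈Q))
  ... | inj₁ (_ , C≡hub) | inj₂ (v∉Q , C≡Q) = v∉Q (subst (v ∈_) (cong proj₁ (trans (sym C≡hub) C≡Q)) v∈hub)
  ... | inj₂ (v∉P , C≡P) | inj₁ (_ , C≡hub) = v∉P (subst (v ∈_) (cong proj₁ (trans (sym C≡hub) C≡P)) v∈hub)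
  ... | inj₂ (_ , C≡P) | inj₂ (_ , C≡Q) = p≢q (cong proj₂ (trans (sym C≡P) C≡Q))

  together : ∀ {u w C c A a B b} → (C , c) ∈ cs₁ → u ∈ C → w ∈ C →
    (A , a) ∈ cs → u ∈ A → (B , b) ∈ cs → w ∈ B → a ≡ b
  together C∈ u∈C w∈C A∈ u∈A B∈ w∈B with combined-cluster C∈ u∈C A∈ u∈A | combined-cluster C∈ w∈C B∈ w∈B
  ... | inj₁ (_ , A≡hub) | inj₁ (_ , B≡hub) = cong proj₂ (trans A≡hub (sym B≡hub))
  ... | inj₁ (v∈C , _) | inj₂ (v∉C , _) = ⊥-elim (v∉C v∈C)
  ... | inj₂ (v∉C , _) | inj₁ (v∈C , _) = ⊥-elim (v∉C v∈C)
  ... | inj₂ (_ , A≡C) | inj₂ (_ , B≡C) = cong proj₂ (trans A≡C (sym B≡C))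

  glued-step : ∀ {u w s′ s₁′} → Step k u w s s′ → Step k u w s₁ s₁′ → Glued v E₁ E₂ S₁ S₂ s′ s₁′ s₂
  glued-step (internal refl _ _ _) (internal refl _ _ _) = G
  glued-step (internal _ C∈ u∈C w∈C) (fusing _ P∈ u∈P Q∈ w∈Q p≢q) =
    ⊥-elim (separated P∈ u∈P Q∈ w∈Q p≢q C∈ u∈C w∈C)
  glued-step (fusing _ A∈ u∈A B∈ w∈B a≢b) (internal _ C∈ u∈C w∈C) =
    ⊥-elim (a≢b (together C∈ u∈C w∈C A∈ u∈A B∈ w∈B))
  glued-step (fusing refl A∈ u∈A B∈ w∈B _) (fusing {P} {_} {Q} refl P∈ u∈P Q∈ w∈Q p≢q) with v ∈? P | v ∈? Q
  ... | yes v∈P | yes v∈Q = ⊥-elim (p≢q (cong proj₂ (disjoint wf₁ P∈ Q∈ v∈P v∈Q)))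
  ... | no v∉P | no v∉Q with disjoint wf A∈ (away₁ P∈ v∉P) u∈A u∈P | disjoint wf B∈ (away₁ Q∈ v∉Q) w∈B w∈Q
  ...   | refl | refl = both-away P∈ v∉P Q∈ v∉Q
  glued-step (fusing refl A∈ u∈A B∈ w∈B _) (fusing refl P∈ u∈P Q∈ w∈Q _) | yes v∈P | no v∉Q
    with disjoint wf₁ P∈ hub∈₁ v∈P v∈hub₁
  ... | refl with disjoint wf A∈ hub∈ u∈A (hub₁⊆hub u∈P) | disjoint wf B∈ (away₁ Q∈ v∉Q) w∈B w∈Q
  ...   | refl | refl = hub-left Q∈ v∉Q
  glued-step (fusing refl A∈ u∈A B∈ w∈B _) (fusing refl P∈ u∈P Q∈ w∈Q _) | no v∉P | yes v∈Q
    with disjoint wf₁ Q∈ hub∈₁ v∈Q v∈hub₁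
  ... | refl with disjoint wf A∈ (away₁ P∈ v∉P) u∈A u∈P | disjoint wf B∈ hub∈ w∈B (hub₁⊆hub w∈Q)
  ...   | refl | refl = hub-right P∈ v∉P

module Gluing (ends : Ends) (V₁ V₂ E₁ E₂ : List ℕ) (v : ℕ)
  (T₁ : IsTree ends V₁ E₁) (T₂ : IsTree ends V₂ E₂) (v∈V₁ : v ∈ V₁) (v∈V₂ : v ∈ V₂)
  (V₁∩V₂ : ∀ x → x ∈ V₁ → x ∈ V₂ → x ≡ v) (E₁∩E₂ : ∀ e → e ∈ E₁ → e ∉ E₂) where

  S₁ S₂ : ℕ → Set
  S₁ = InS ends V₁ E₁ v
  S₂ = InS ends V₂ E₂ v

  endsIn : EndsIn ends (V₁ ++ V₂) (E₁ ++ E₂)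
  endsIn e e∈E with ∈-++⁻ E₁ e∈E
  ... | inj₁ e∈E₁ = let (u∈V₁ , w∈V₁) = IsTree.endsInV T₁ e e∈E₁ in ∈-++⁺ˡ u∈V₁ , ∈-++⁺ˡ w∈V₁
  ... | inj₂ e∈E₂ = let (u∈V₂ , w∈V₂) = IsTree.endsInV T₂ e e∈E₂ in ∈-++⁺ʳ V₁ u∈V₂ , ∈-++⁺ʳ V₁ w∈V₂

  module R  = Run ends (V₁ ++ V₂) (E₁ ++ E₂) endsIn
  module R₁ = Run ends V₁ E₁ (IsTree.endsInV T₁)
  module R₂ = Run ends V₂ E₂ (IsTree.endsInV T₂)

  labelled₁ : ∀ k → SpineLabelled v S₁ (clusters (R₁.state k))
  labelled₁ k = R₁.Spine.SpineInvariant.spine-labelled (R₁.Spine.spineInvariant v (tree-loopless T₁) k)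

  labelled₂ : ∀ k → SpineLabelled v S₂ (clusters (R₂.state k))
  labelled₂ k = R₂.Spine.SpineInvariant.spine-labelled (R₂.Spine.spineInvariant v (tree-loopless T₂) k)

  glued-initial : Glued v E₁ E₂ S₁ S₂ (R.state 0) (R₁.state 0) (R₂.state 0)
  glued-initial = record
    { away₁ = λ C∈ _ → initial-mono ∈-++⁺ˡ C∈
    ; away₂ = λ C∈ _ → initial-mono (∈-++⁺ʳ V₁) C∈
    ; hub = [ v ] ; hub₁ = [ v ] ; hub₂ = [ v ]
    ; hubLabel = leaf v ; hubLabel₁ = leaf v ; hubLabel₂ = leaf v
    ; hub∈ = ∈-initial (∈-++⁺ˡ v∈V₁) ; hub∈₁ = ∈-initial v∈V₁ ; hub∈₂ = ∈-initial v∈V₂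
    ; v∈hub = here refl ; v∈hub₁ = here refl ; v∈hub₂ = here refl
    ; hub₁⊆hub = λ x∈ → x∈ ; hub₂⊆hub = λ x∈ → x∈ ; hubLabel-inherited = inj₁ refl
    ; parents₁ = λ _ _ _ → refl ; parents₂ = λ _ _ _ → refl }

  Glued-at : ℕ → Set
  Glued-at k = Glued v E₁ E₂ S₁ S₂ (R.state k) (R₁.state k) (R₂.state k)

  glued-step₁ : ∀ {k u w} → Glued-at k → Step k u w (R.state k) (R.state (suc k)) →
                Step k u w (R₁.state k) (R₁.state (suc k)) → R₂.state (suc k) ≡ R₂.state k → Glued-at (suc k)
  glued-step₁ {k} G step step₁ eq₂ rewrite eq₂ =
    GluedStep.glued-step V₁ V₂ E₁ E₂ v S₁ S₂ V₁∩V₂ E₁∩E₂ k (R.state k) (R₁.state k) (R₂.state k)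
      (R.wellFormed k) (R₁.wellFormed k) (R₂.wellFormed k) (labelled₁ k) (labelled₂ k) G step step₁

  glued-step₂ : ∀ {k u w} → Glued-at k → Step k u w (R.state k) (R.state (suc k)) →
                Step k u w (R₂.state k) (R₂.state (suc k)) → R₁.state (suc k) ≡ R₁.state k → Glued-at (suc k)
  glued-step₂ {k} G step step₂ eq₁ rewrite eq₁ =
    Glued-swap (GluedStep.glued-step V₂ V₁ E₂ E₁ v S₂ S₁ (λ x x∈V₂ x∈V₁ → V₁∩V₂ x x∈V₁ x∈V₂)
      (λ e e∈E₂ e∈E₁ → E₁∩E₂ e e∈E₁ e∈E₂) k (R.state k) (R₂.state k) (R₁.state k)
      (R.wellFormed k) (R₂.wellFormed k) (R₁.wellFormed k) (labelled₂ k) (labelled₁ k) (Glued-swap G)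
      step step₂)

  glued : ∀ k → Glued-at k
  glued zero = glued-initial
  glued (suc k) with R.transition k | R₁.transition k | R₂.transition k
  ... | R.skip _ eq | R₁.skip _ eq₁ | R₂.skip _ eq₂ rewrite eq | eq₁ | eq₂ = glued k
  ... | R.skip k∉E _ | R₁.edge k∈E₁ _ | _ = ⊥-elim (k∉E (∈-++⁺ˡ k∈E₁))
  ... | R.skip k∉E _ | _ | R₂.edge k∈E₂ _ = ⊥-elim (k∉E (∈-++⁺ʳ E₁ k∈E₂))
  ... | R.edge k∈E _ | R₁.skip k∉E₁ _ | R₂.skip k∉E₂ _ = ⊥-elim ([ k∉E₁ , k∉E₂ ]′ (∈-++⁻ E₁ k∈E))
  ... | R.edge _ _ | R₁.edge k∈E₁ _ | R₂.edge k∈E₂ _ = ⊥-elim (E₁∩E₂ k k∈E₁ k∈E₂)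
  ... | R.edge _ step | R₁.edge _ step₁ | R₂.skip _ eq₂ = glued-step₁ (glued k) step step₁ eq₂
  ... | R.edge _ step | R₁.skip _ eq₁ | R₂.edge _ step₂ = glued-step₂ (glued k) step step₂ eq₁

lemma3p4 : (ends : Ends) (V₁ V₂ E₁ E₂ : List ℕ) (v : ℕ) →
    IsTree ends V₁ E₁ → IsTree ends V₂ E₂ →
    v ∈ V₁ → v ∈ V₂ → (∀ x → x ∈ V₁ → x ∈ V₂ → x ≡ v) →
    (∀ e → e ∈ E₁ → e ∉ E₂) →
    (∀ e → e ∈ E₁ → ¬ InS ends V₁ E₁ v e →
       parent ends (V₁ ++ V₂) (E₁ ++ E₂) e ≡ parent ends V₁ E₁ e)
    × (∀ e → e ∈ E₂ → ¬ InS ends V₂ E₂ v e →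
       parent ends (V₁ ++ V₂) (E₁ ++ E₂) e ≡ parent ends V₂ E₂ e)
lemma3p4 ends V₁ V₂ E₁ E₂ v T₁ T₂ v∈V₁ v∈V₂ V₁∩V₂ E₁∩E₂ = agree₁ , agree₂
  where
  open Gluing ends V₁ V₂ E₁ E₂ v T₁ T₂ v∈V₁ v∈V₂ V₁∩V₂ E₁∩E₂
  open Glued (glued (suc (maxRank (E₁ ++ E₂))))

  agree₁ : ∀ e → e ∈ E₁ → ¬ S₁ e → parent ends (V₁ ++ V₂) (E₁ ++ E₂) e ≡ parent ends V₁ E₁ e
  agree₁ e e∈E₁ e∉S₁ = trans (parents₁ e e∈E₁ e∉S₁)
    (cong (lookupParent (node e) ∘ links) (R₁.state-run (λ f f∈E₁ → R.below-final f (∈-++⁺ˡ f∈E₁))))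

  agree₂ : ∀ e → e ∈ E₂ → ¬ S₂ e → parent ends (V₁ ++ V₂) (E₁ ++ E₂) e ≡ parent ends V₂ E₂ e
  agree₂ e e∈E₂ e∉S₂ = trans (parents₂ e e∈E₂ e∉S₂)
    (cong (lookupParent (node e) ∘ links) (R₂.state-run (λ f f∈E₂ → R.below-final f (∈-++⁺ʳ E₁ f∈E₂))))
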